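{- Let $q$ be a prime power. In $PG(3,q)$ with homogeneous coordinates $(x_0,x_1,x_2,x_3)$, let $l_1:\ x_0=x_2=0$, $l_2:\ x_1=x_3=0$, $l_3:\ x_0=x_3,\ x_1=x_2$, let $\mathcal{Q}$ be the hyperbolic quadric $x_0x_1=x_2x_3$, and let $g$ be any line of $PG(3,q)$ disjoint from $\mathcal{Q}$. Then $B=l_1\cup l_2\cup l_3\cup g$ has size $4q+4$ and is a $3$-fold strong blocking set in $PG(3,q)$.
   Context: For $2\leq t\leq v$, a point set $B$ in $PG(v,q)$ is a $t$-fold strong blocking set if every $(t-1)$-dimensional subspace of $PG(v,q)$ is spanned by $t$ points of $B$. Thus a $3$-fold strong blocking set in $PG(3,q)$ is a set such that every plane contains three non-collinear points of the set. -}

module Defs where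

open import Level using (0ℓ)
open import Data.Nat using (ℕ)
open import Data.Fin using (Fin; #_)
open import Data.Product using (Σ; ∃; _×_; _,_)
open import Data.Sum using (_⊎_)
open import Relation.Nullary using (¬_)
open import Relation.Binary using (Decidable)
open import Relation.Binary.PropositionalEquality using (_≡_)
open import Algebra.Bundles using (CommutativeRing)

-- A finite field with exactly q elements (q is then necessarily a prime
-- power; every such field is GF(q)).  Equality is the setoid equality _≈_.
record FiniteField (q : ℕ) : Set₁ where
  field
    commRing : CommutativeRing 0ℓ 0ℓ
  open CommutativeRing commRing public
  field
    _≟_     : Decidable _≈_
    0≉1     : ¬ (0# ≈ 1#)
    inverse : ∀ x → ¬ (x ≈ 0#) → ∃ λ y → x * y ≈ 1#
    enum       : Fin q → Carrier
    enum-inj   : ∀ i j → enum i ≈ enum j → i ≡ j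
    enum-surj  : ∀ x → ∃ λ i → enum i ≈ x

-- Projective space PG(3,q) over F, points represented by nonzero vectors
-- of F^4 (homogeneous coordinates x0,x1,x2,x3), up to proportionality.
module PG {q : ℕ} (F : FiniteField q) where
  open FiniteField F

  Vec4 : Set
  Vec4 = Fin 4 → Carrier

  x0 x1 x2 x3 : Vec4 → Carrier
  x0 v = v (# 0)
  x1 v = v (# 1)
  x2 v = v (# 2)
  x3 v = v (# 3)

  _≈v_ : Vec4 → Vec4 → Set
  u ≈v v = ∀ i → u i ≈ v i

  zeroV : Vec4
  zeroV _ = 0#

  NonZero : Vec4 → Set
  NonZero v = ¬ (v ≈v zeroV)

  -- u and v represent the same projective point (when both nonzero)
  SamePoint : Vec4 → Vec4 → Set
  SamePoint u v = ∃ λ c → ∀ i → u i ≈ c * v i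

  lin2 : Carrier → Vec4 → Carrier → Vec4 → Vec4
  lin2 a u b w i = a * u i + b * w i

  lin3 : Carrier → Vec4 → Carrier → Vec4 → Carrier → Vec4 → Vec4
  lin3 a u b w c z i = a * u i + b * w i + c * z i

  Indep2 : Vec4 → Vec4 → Set
  Indep2 u w = ∀ a b → lin2 a u b w ≈v zeroV → (a ≈ 0#) × (b ≈ 0#)

  Indep3 : Vec4 → Vec4 → Vec4 → Set
  Indep3 u w z = ∀ a b c → lin3 a u b w c z ≈v zeroV →
                 (a ≈ 0#) × (b ≈ 0#) × (c ≈ 0#)

  OnLine : Vec4 → Vec4 → Vec4 → Set
  OnLine u w v = ∃ λ a → ∃ λ b → v ≈v lin2 a u b w

  OnL1 OnL2 OnL3 : Vec4 → Set
  OnL1 v = (x0 v ≈ 0#) × (x2 v ≈ 0#)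
  OnL2 v = (x1 v ≈ 0#) × (x3 v ≈ 0#)
  OnL3 v = (x0 v ≈ x3 v) × (x1 v ≈ x2 v)

  OnQ : Vec4 → Set
  OnQ v = x0 v * x1 v ≈ x2 v * x3 v

  DisjointFromQ : Vec4 → Vec4 → Set
  DisjointFromQ u w = ∀ v → NonZero v → OnLine u w v → ¬ OnQ v

  InB : Vec4 → Vec4 → Vec4 → Set
  InB u w v = NonZero v × (OnL1 v ⊎ OnL2 v ⊎ OnL3 v ⊎ OnLine u w v)

  HasSize : (Vec4 → Set) → ℕ → Set
  HasSize P n =
    Σ (Fin n → Vec4) λ f →
      (∀ i → P (f i)) ×
      (∀ i j → SamePoint (f i) (f j) → i ≡ j) ×
      (∀ v → P v → ∃ λ i → SamePoint v (f i))

  -- planes are kernels of nonzero linear forms a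
  OnPlane : Vec4 → Vec4 → Set
  OnPlane a v = a (# 0) * x0 v + a (# 1) * x1 v + a (# 2) * x2 v + a (# 3) * x3 v ≈ 0#

  SpansPlane : Vec4 → Vec4 → Vec4 → Vec4 → Set
  SpansPlane a v1 v2 v3 =
    OnPlane a v1 × OnPlane a v2 × OnPlane a v3 ×
    (∀ x → OnPlane a x → ∃ λ c1 → ∃ λ c2 → ∃ λ c3 → x ≈v lin3 c1 v1 c2 v2 c3 v3)

  ThreeFoldStrongBlocking : (Vec4 → Set) → Set
  ThreeFoldStrongBlocking P =
    ∀ a → NonZero a →
      ∃ λ v1 → ∃ λ v2 → ∃ λ v3 →
        P v1 × P v2 × P v3 × SpansPlane a v1 v2 v3

-- Write a plane as ker a.  If it contains l₁ (a₁ = a₃ = 0) or l₂ (a₀ = a₂ = 0),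
-- two points of that line and the point where the plane meets the other one
-- span it.  Otherwise it meets l₁, l₂, l₃ in single points P₁, P₂, P₃; their
-- cofactor vector is (a₀a₁ - a₂a₃)·a, so they span the plane unless it is
-- tangent to Q.  A tangent plane meets g in a point R off Q, and the cofactor
-- vector of P₁, P₂, R is then a nonzero multiple of a.  For the size: l₁, l₂, l₃
-- are pairwise disjoint lines on Q and g misses Q, so B is a disjoint union of
-- four lines of q + 1 points.

module Submission where

open import Defs
open import Algebra.Bundles using (CommutativeRing; RawRing)
open import Algebra.Solver.Ring.AlmostCommutativeRing
  using (fromCommutativeRing; _-Raw-AlmostCommutative⟶_)
open import Data.Empty using (⊥; ⊥-elim)
open import Data.Fin as Fin using (Fin; splitAt; join)
open import Data.Fin.Patterns using (0F; 1F; 2F; 3F)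
open import Data.Fin.Properties using (¬∀⟶∃¬; splitAt-join; join-splitAt)
open import Data.Integer as ℤ using (ℤ; +_; -[1+_]; _⊖_)
import Data.Integer.Properties as ℤ
open import Data.Maybe using (map)
open import Data.Nat as ℕ using (ℕ; zero; suc)
import Data.Nat.Properties as ℕ
open import Data.Nat.Tactic.RingSolver using (solve-∀)
open import Data.Product using (∃; _×_; _,_; proj₁; proj₂)
open import Data.Sum as Sum using (_⊎_; inj₁; inj₂)
open import Data.Vec.N-ary using (N-ary; N-ary-level)
open import Function using (_∘_)
open import Level using (0ℓ)
open import Relation.Binary.Consequences using (dec⇒weaklyDec)
open import Relation.Binary.PropositionalEquality as ≡ using (_≡_)
open import Relation.Nullary using (¬_; yes; no; contradiction; _×-dec_)
open import Relation.Unary using (_∪_; _≐_)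

-- The ring solver needs coefficients with a computable equality; ℤ maps into
-- every commutative ring, whereas equality in the field itself does not compute.
module IntegerCoefficientSolver {c ℓ} (R : CommutativeRing c ℓ) where
  open CommutativeRing R
  open import Algebra.Properties.Ring ring
    using (-‿involutive; -0#≈0#; -‿distribˡ-*; -‿+-comm)
  open import Algebra.Properties.Semiring.Mult.TCOptimised semiring
    using (1+×; ×-homo-+) renaming (_×_ to _×′_)
  open import Relation.Binary.Reasoning.Setoid setoid

  -- With the optimised multiplication ⟦ + 0 ⟧ℤ and ⟦ + 1 ⟧ℤ are 0# and 1#
  -- definitionally, so solved equations may mention 0# and 1# directly.
  ⟦_⟧ℤ : ℤ → Carrier
  ⟦ + n ⟧ℤ      = n ×′ 1#
  ⟦ -[1+ n ] ⟧ℤ = - (suc n ×′ 1#)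

  ⟦-⟧ℤ : ∀ i → ⟦ ℤ.- i ⟧ℤ ≈ - ⟦ i ⟧ℤ
  ⟦-⟧ℤ (+ zero)  = sym -0#≈0#
  ⟦-⟧ℤ (+ suc n) = refl
  ⟦-⟧ℤ -[1+ n ]  = sym (-‿involutive _)

  ⟦⊖⟧ℤ : ∀ m n → ⟦ m ⊖ n ⟧ℤ ≈ m ×′ 1# - n ×′ 1#
  ⟦⊖⟧ℤ m zero = begin
    ⟦ m ⊖ 0 ⟧ℤ         ≡⟨ ≡.cong ⟦_⟧ℤ (ℤ.⊖-≥ {m} ℕ.z≤n) ⟩
    m ×′ 1#            ≈⟨ +-identityʳ _ ⟨
    m ×′ 1# + 0#       ≈⟨ +-congˡ -0#≈0# ⟨
    m ×′ 1# - 0 ×′ 1#  ∎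
  ⟦⊖⟧ℤ zero (suc n) = sym (+-identityˡ _)
  ⟦⊖⟧ℤ (suc m) (suc n) = begin
    ⟦ suc m ⊖ suc n ⟧ℤ                 ≡⟨ ≡.cong ⟦_⟧ℤ (ℤ.[1+m]⊖[1+n]≡m⊖n m n) ⟩
    ⟦ m ⊖ n ⟧ℤ                         ≈⟨ ⟦⊖⟧ℤ m n ⟩
    M - N                              ≈⟨ +-identityˡ _ ⟨
    0# + (M - N)                       ≈⟨ +-congʳ (-‿inverseʳ 1#) ⟨
    (1# - 1#) + (M - N)                ≈⟨ +-assoc _ _ _ ⟩
    1# + (- 1# + (M - N))              ≈⟨ +-congˡ (+-assoc _ _ _) ⟨
    1# + ((- 1# + M) - N)              ≈⟨ +-congˡ (+-congʳ (+-comm _ _)) ⟩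
    1# + ((M - 1#) - N)                ≈⟨ +-congˡ (+-assoc _ _ _) ⟩
    1# + (M + (- 1# - N))              ≈⟨ +-congˡ (+-congˡ (-‿+-comm _ _)) ⟩
    1# + (M - (1# + N))                ≈⟨ +-assoc _ _ _ ⟨
    (1# + M) - (1# + N)                ≈⟨ +-cong (1+× m 1#) (-‿cong (1+× n 1#)) ⟨
    suc m ×′ 1# - suc n ×′ 1#          ∎
    where
    M N : Carrier
    M = m ×′ 1#
    N = n ×′ 1#

  ⟦+⟧ℤ : ∀ i j → ⟦ i ℤ.+ j ⟧ℤ ≈ ⟦ i ⟧ℤ + ⟦ j ⟧ℤ
  ⟦+⟧ℤ (+ m)    (+ n)    = ×-homo-+ 1# m n
  ⟦+⟧ℤ (+ m)    -[1+ n ] = ⟦⊖⟧ℤ m (suc n)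
  ⟦+⟧ℤ -[1+ m ] (+ n)    = trans (⟦⊖⟧ℤ n (suc m)) (+-comm _ _)
  ⟦+⟧ℤ -[1+ m ] -[1+ n ] = begin
    - (suc (suc (m ℕ.+ n)) ×′ 1#)      ≡⟨ ≡.cong (λ k → - (k ×′ 1#)) (ℕ.+-suc (suc m) n) ⟨
    - ((suc m ℕ.+ suc n) ×′ 1#)        ≈⟨ -‿cong (×-homo-+ 1# (suc m) (suc n)) ⟩
    - (suc m ×′ 1# + suc n ×′ 1#)      ≈⟨ -‿+-comm _ _ ⟨
    - (suc m ×′ 1#) + - (suc n ×′ 1#)  ∎

  ⟦+*⟧ℤ : ∀ n j → ⟦ + n ℤ.* j ⟧ℤ ≈ ⟦ + n ⟧ℤ * ⟦ j ⟧ℤ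
  ⟦+*⟧ℤ zero    j = sym (zeroˡ ⟦ j ⟧ℤ)
  ⟦+*⟧ℤ (suc n) j = begin
    ⟦ + suc n ℤ.* j ⟧ℤ               ≡⟨ ≡.cong ⟦_⟧ℤ (ℤ.*-distribʳ-+ j (+ 1) (+ n)) ⟩
    ⟦ + 1 ℤ.* j ℤ.+ + n ℤ.* j ⟧ℤ     ≈⟨ ⟦+⟧ℤ (+ 1 ℤ.* j) (+ n ℤ.* j) ⟩
    ⟦ + 1 ℤ.* j ⟧ℤ + ⟦ + n ℤ.* j ⟧ℤ  ≈⟨ +-cong (reflexive (≡.cong ⟦_⟧ℤ (ℤ.*-identityˡ j))) (⟦+*⟧ℤ n j) ⟩
    ⟦ j ⟧ℤ + n ×′ 1# * ⟦ j ⟧ℤ        ≈⟨ +-congʳ (*-identityˡ _) ⟨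
    1# * ⟦ j ⟧ℤ + n ×′ 1# * ⟦ j ⟧ℤ   ≈⟨ distribʳ _ _ _ ⟨
    (1# + n ×′ 1#) * ⟦ j ⟧ℤ          ≈⟨ *-congʳ (1+× n 1#) ⟨
    suc n ×′ 1# * ⟦ j ⟧ℤ             ∎

  ⟦*⟧ℤ : ∀ i j → ⟦ i ℤ.* j ⟧ℤ ≈ ⟦ i ⟧ℤ * ⟦ j ⟧ℤ
  ⟦*⟧ℤ (+ n)    j = ⟦+*⟧ℤ n j
  ⟦*⟧ℤ -[1+ n ] j = begin
    ⟦ -[1+ n ] ℤ.* j ⟧ℤ       ≡⟨ ≡.cong ⟦_⟧ℤ (ℤ.neg-distribˡ-* (+ suc n) j) ⟨
    ⟦ ℤ.- (+ suc n ℤ.* j) ⟧ℤ  ≈⟨ ⟦-⟧ℤ (+ suc n ℤ.* j) ⟩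
    - ⟦ + suc n ℤ.* j ⟧ℤ      ≈⟨ -‿cong (⟦+*⟧ℤ (suc n) j) ⟩
    - (suc n ×′ 1# * ⟦ j ⟧ℤ)  ≈⟨ -‿distribˡ-* _ _ ⟩
    - (suc n ×′ 1#) * ⟦ j ⟧ℤ  ∎

  ℤ⟶R : ℤ.+-*-rawRing -Raw-AlmostCommutative⟶ fromCommutativeRing R
  ℤ⟶R = record
    { ⟦_⟧    = ⟦_⟧ℤ
    ; +-homo = ⟦+⟧ℤ
    ; *-homo = ⟦*⟧ℤ
    ; -‿homo = ⟦-⟧ℤ
    ; 0-homo = refl
    ; 1-homo = refl
    }

  open import Algebra.Solver.Ring ℤ.+-*-rawRing (fromCommutativeRing R) ℤ⟶R
    (λ i j → map (reflexive ∘ ≡.cong ⟦_⟧ℤ) (dec⇒weaklyDec ℤ._≟_ i j)) public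

  polynomials : ℕ → RawRing _ _
  polynomials n = record
    { Carrier = Polynomial n
    ; _≈_     = _≡_
    ; _+_     = _:+_
    ; _*_     = _:*_
    ; -_      = :-_
    ; 0#      = con (+ 0)
    ; 1#      = con (+ 1)
    }

record Triple : Set where
  constructor triple
  field i j l : Fin 4

_∈ᵗ_ : Fin 4 → Triple → Set
m ∈ᵗ triple i j l = m ≡ i ⊎ m ≡ j ⊎ m ≡ l

-- The coordinates other than k, ordered so that the minor on them is the
-- signed cofactor of the k-th coordinate.
complement : Fin 4 → Triple
complement 0F = triple 1F 2F 3F
complement 1F = triple 2F 0F 3F
complement 2F = triple 0F 1F 3F
complement 3F = triple 1F 0F 2F

complement-cover : ∀ k m → m ≡ k ⊎ m ∈ᵗ complement k
complement-cover 0F 0F = inj₁ ≡.refl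
complement-cover 0F 1F = inj₂ (inj₁ ≡.refl)
complement-cover 0F 2F = inj₂ (inj₂ (inj₁ ≡.refl))
complement-cover 0F 3F = inj₂ (inj₂ (inj₂ ≡.refl))
complement-cover 1F 0F = inj₂ (inj₂ (inj₁ ≡.refl))
complement-cover 1F 1F = inj₁ ≡.refl
complement-cover 1F 2F = inj₂ (inj₁ ≡.refl)
complement-cover 1F 3F = inj₂ (inj₂ (inj₂ ≡.refl))
complement-cover 2F 0F = inj₂ (inj₁ ≡.refl)
complement-cover 2F 1F = inj₂ (inj₂ (inj₁ ≡.refl))
complement-cover 2F 2F = inj₁ ≡.refl
complement-cover 2F 3F = inj₂ (inj₂ (inj₂ ≡.refl))
complement-cover 3F 0F = inj₂ (inj₂ (inj₁ ≡.refl))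
complement-cover 3F 1F = inj₂ (inj₁ ≡.refl)
complement-cover 3F 2F = inj₂ (inj₂ (inj₂ ≡.refl))
complement-cover 3F 3F = inj₁ ≡.refl

module Coordinates {c ℓ} (R : RawRing c ℓ) where
  open RawRing R

  private
    infixl 6 _-_
    _-_ : Carrier → Carrier → Carrier
    x - y = x + - y

  Vec4 : Set c
  Vec4 = Fin 4 → Carrier

  vec : Carrier → Carrier → Carrier → Carrier → Vec4
  vec x₀ x₁ x₂ x₃ 0F = x₀
  vec x₀ x₁ x₂ x₃ 1F = x₁
  vec x₀ x₁ x₂ x₃ 2F = x₂
  vec x₀ x₁ x₂ x₃ 3F = x₃

  e : Fin 4 → Vec4
  e 0F = vec 1# 0# 0# 0#
  e 1F = vec 0# 1# 0# 0#
  e 2F = vec 0# 0# 1# 0#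
  e 3F = vec 0# 0# 0# 1#

  infixr 7 _•_
  _•_ : Carrier → Vec4 → Vec4
  (μ • v) i = μ * v i

  infix 8 _·_
  _·_ : Vec4 → Vec4 → Carrier
  a · v = a 0F * v 0F + a 1F * v 1F + a 2F * v 2F + a 3F * v 3F

  infix 8 _·⟨_⟩_
  _·⟨_⟩_ : Vec4 → Triple → Vec4 → Carrier
  a ·⟨ triple i j l ⟩ v = a i * v i + a j * v j + a l * v l

  lin2 : Carrier → Vec4 → Carrier → Vec4 → Vec4
  lin2 α u β w i = α * u i + β * w i

  lin3 : Carrier → Vec4 → Carrier → Vec4 → Carrier → Vec4 → Vec4
  lin3 α u β v γ w i = α * u i + β * v i + γ * w i

  -- Q is the zero set of quad; since Q is self-dual, the plane ker a is
  -- tangent to Q exactly when quad a vanishes.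
  quad : Vec4 → Carrier
  quad v = v 0F * v 1F - v 2F * v 3F

  det3 : (a₁ a₂ a₃ b₁ b₂ b₃ c₁ c₂ c₃ : Carrier) → Carrier
  det3 a₁ a₂ a₃ b₁ b₂ b₃ c₁ c₂ c₃ =
    a₁ * (b₂ * c₃ - b₃ * c₂) - a₂ * (b₁ * c₃ - b₃ * c₁) + a₃ * (b₁ * c₂ - b₂ * c₁)

  minor : Triple → Vec4 → Vec4 → Vec4 → Carrier
  minor (triple i j l) u v w = det3 (u i) (u j) (u l) (v i) (v j) (v l) (w i) (w j) (w l)

  -- cross u v w · x is the 4×4 determinant with rows x, u, v, w.
  cross : Vec4 → Vec4 → Vec4 → Vec4
  cross u v w k = minor (complement k) u v w

  l₁-point l₂-point l₃-point : Vec4 → Vec4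
  l₁-point a = vec 0# (a 3F) 0# (- a 1F)
  l₂-point a = vec (a 2F) 0# (- a 0F) 0#
  l₃-point a = vec (a 1F + a 2F) (- (a 0F + a 3F)) (- (a 0F + a 3F)) (a 1F + a 2F)

module _ {q : ℕ} (F : FiniteField q) where
  open FiniteField F hiding (zero)
  open PG F
  open IntegerCoefficientSolver commRing
    using (Polynomial; solve; _:=_; _:+_; _:*_; :-_; _:-_; con; polynomials)
  open Coordinates rawRing hiding (Vec4; lin2; lin3)
  -- At the polynomial instance every definition of Coordinates becomes solver
  -- syntax whose meaning is, definitionally, the same definition in the field.
  module ᴾ {n} = Coordinates (polynomials n)
  open import Algebra.Properties.Ring ring using (-0#≈0#; -‿distribʳ-*; +-cancelʳ)
  open import Algebra.Properties.Group +-group using (⁻¹-injective; x∙y⁻¹≈ε⇒x≈y; x≈y⇒x∙y⁻¹≈ε)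
  open import Relation.Binary.Reasoning.Setoid setoid

  1≉0 : ¬ 1# ≈ 0#
  1≉0 1≈0 = 0≉1 (sym 1≈0)

  x*y≈0⇒y≈0 : ∀ {x y} → ¬ x ≈ 0# → x * y ≈ 0# → y ≈ 0#
  x*y≈0⇒y≈0 {x} {y} x≉0 xy≈0 with inverse x x≉0
  ... | x⁻¹ , xx⁻¹≈1 = begin
    y               ≈⟨ *-identityˡ y ⟨
    1# * y          ≈⟨ *-congʳ xx⁻¹≈1 ⟨
    x * x⁻¹ * y     ≈⟨ *-congʳ (*-comm x x⁻¹) ⟩
    x⁻¹ * x * y     ≈⟨ *-assoc x⁻¹ x y ⟩
    x⁻¹ * (x * y)   ≈⟨ *-congˡ xy≈0 ⟩
    x⁻¹ * 0#        ≈⟨ zeroʳ x⁻¹ ⟩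
    0#              ∎

  *-≉0 : ∀ {x y} → ¬ x ≈ 0# → ¬ y ≈ 0# → ¬ x * y ≈ 0#
  *-≉0 x≉0 y≉0 = y≉0 ∘ x*y≈0⇒y≈0 x≉0

  *-cancelˡ-≉0 : ∀ {a x y} → ¬ a ≈ 0# → a * x ≈ a * y → x ≈ y
  *-cancelˡ-≉0 {a} {x} {y} a≉0 ax≈ay = x∙y⁻¹≈ε⇒x≈y x y (x*y≈0⇒y≈0 a≉0 (begin
    a * (x - y)      ≈⟨ distribˡ a x (- y) ⟩
    a * x + a * - y  ≈⟨ +-cong ax≈ay (sym (-‿distribʳ-* a y)) ⟩
    a * y - a * y    ≈⟨ -‿inverseʳ (a * y) ⟩
    0#               ∎))

  -x≈0⇒x≈0 : ∀ {x} → - x ≈ 0# → x ≈ 0#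
  -x≈0⇒x≈0 -x≈0 = ⁻¹-injective (trans -x≈0 (sym -0#≈0#))

  ≉0-pair : ∀ {x y} → ¬ (x ≈ 0# × y ≈ 0#) → ¬ x ≈ 0# ⊎ ¬ y ≈ 0#
  ≉0-pair {x} {y} ¬both with x ≟ 0#
  ... | yes x≈0 = inj₂ (λ y≈0 → ¬both (x≈0 , y≈0))
  ... | no  x≉0 = inj₁ x≉0

  nonzero-coordinate : ∀ {a} → NonZero a → ∃ λ k → ¬ a k ≈ 0#
  nonzero-coordinate {a} a≉0 = ¬∀⟶∃¬ 4 (λ k → a k ≈ 0#) (λ k → a k ≟ 0#) a≉0

  ideal-member≈0 : ∀ {s t u} X Y Z → s ≈ 0# → t ≈ 0# → u ≈ 0# → X * s + Y * t + Z * u ≈ 0#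
  ideal-member≈0 {s} {t} {u} X Y Z s≈0 t≈0 u≈0 = begin
    X * s + Y * t + Z * u     ≈⟨ +-cong (+-cong (*-congˡ s≈0) (*-congˡ t≈0)) (*-congˡ u≈0) ⟩
    X * 0# + Y * 0# + Z * 0#  ≈⟨ +-cong (+-cong (zeroʳ X) (zeroʳ Y)) (zeroʳ Z) ⟩
    0# + 0# + 0#              ≈⟨ trans (+-identityʳ _) (+-identityʳ 0#) ⟩
    0#                        ∎

  move-inverse : ∀ {d d⁻¹ x z} → d * d⁻¹ ≈ 1# → d * x ≈ z → x ≈ d⁻¹ * z
  move-inverse {d} {d⁻¹} {x} {z} dd⁻¹≈1 dx≈z = begin
    x               ≈⟨ *-identityˡ x ⟨
    1# * x          ≈⟨ *-congʳ (trans (sym dd⁻¹≈1) (*-comm d d⁻¹)) ⟩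
    d⁻¹ * d * x     ≈⟨ *-assoc d⁻¹ d x ⟩
    d⁻¹ * (d * x)   ≈⟨ *-congˡ dx≈z ⟩
    d⁻¹ * z         ∎

  ≈-modulo : ∀ {x y z w} → x + z * y ≈ w → z ≈ 0# → x ≈ w
  ≈-modulo {x} {y} {z} {w} x+zy≈w z≈0 = begin
    x            ≈⟨ +-identityʳ x ⟨
    x + 0#       ≈⟨ +-congˡ (trans (*-congʳ z≈0) (zeroˡ y)) ⟨
    x + z * y    ≈⟨ x+zy≈w ⟩
    w            ∎

  1*x+0*y≈x : ∀ x y → 1# * x + 0# * y ≈ x
  1*x+0*y≈x = solve 2 (λ x y → con (+ 1) :* x :+ con (+ 0) :* y := x) refl

  x*1+y*0≈x : ∀ x y → x * 1# + y * 0# ≈ x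
  x*1+y*0≈x = solve 2 (λ x y → x :* con (+ 1) :+ y :* con (+ 0) := x) refl

  x*0+y*1≈y : ∀ x y → x * 0# + y * 1# ≈ y
  x*0+y*1≈y = solve 2 (λ x y → x :* con (+ 0) :+ y :* con (+ 1) := y) refl

  x*0+y*0≈0 : ∀ x y → x * 0# + y * 0# ≈ 0#
  x*0+y*0≈0 = solve 2 (λ x y → x :* con (+ 0) :+ y :* con (+ 0) := con (+ 0)) refl

  Equation : (n : ℕ) → Set (N-ary-level 0ℓ 0ℓ n)
  Equation n = N-ary n (Polynomial n) (Polynomial n × Polynomial n)

  ·-lin2 : ∀ a α u β w → a · lin2 α u β w ≈ α * (a · u) + β * (a · w)
  ·-lin2 a α u β w = solve 14
    (λ a₀ a₁ a₂ a₃ α β u₀ u₁ u₂ u₃ w₀ w₁ w₂ w₃ →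
       let A = ᴾ.vec a₀ a₁ a₂ a₃; U = ᴾ.vec u₀ u₁ u₂ u₃; W = ᴾ.vec w₀ w₁ w₂ w₃ in
       A ᴾ.· ᴾ.lin2 α U β W := α :* (A ᴾ.· U) :+ β :* (A ᴾ.· W))
    refl (a 0F) (a 1F) (a 2F) (a 3F) α β
         (u 0F) (u 1F) (u 2F) (u 3F) (w 0F) (w 1F) (w 2F) (w 3F)

  ·-lin3 : ∀ a α u β v γ w →
           a · lin3 α u β v γ w ≈ α * (a · u) + β * (a · v) + γ * (a · w)
  ·-lin3 a α u β v γ w = solve 19
    (λ a₀ a₁ a₂ a₃ α β γ u₀ u₁ u₂ u₃ v₀ v₁ v₂ v₃ w₀ w₁ w₂ w₃ →
       let A = ᴾ.vec a₀ a₁ a₂ a₃; U = ᴾ.vec u₀ u₁ u₂ u₃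
           V = ᴾ.vec v₀ v₁ v₂ v₃; W = ᴾ.vec w₀ w₁ w₂ w₃ in
       A ᴾ.· ᴾ.lin3 α U β V γ W := α :* (A ᴾ.· U) :+ β :* (A ᴾ.· V) :+ γ :* (A ᴾ.· W))
    refl (a 0F) (a 1F) (a 2F) (a 3F) α β γ (u 0F) (u 1F) (u 2F) (u 3F)
         (v 0F) (v 1F) (v 2F) (v 3F) (w 0F) (w 1F) (w 2F) (w 3F)

  ·⟨⟩-cong : ∀ a t {x y} → (∀ m → m ∈ᵗ t → x m ≈ y m) → a ·⟨ t ⟩ x ≈ a ·⟨ t ⟩ y
  ·⟨⟩-cong a (triple i j l) x≈y =
    +-cong (+-cong (*-congˡ (x≈y i (inj₁ ≡.refl))) (*-congˡ (x≈y j (inj₂ (inj₁ ≡.refl)))))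
           (*-congˡ (x≈y l (inj₂ (inj₂ ≡.refl))))

  ·-split : ∀ a v k → a · v ≈ a k * v k + a ·⟨ complement k ⟩ v
  ·-split a v = λ where
      0F → solve 8 (identity 0F) refl a₀ a₁ a₂ a₃ v₀ v₁ v₂ v₃
      1F → solve 8 (identity 1F) refl a₀ a₁ a₂ a₃ v₀ v₁ v₂ v₃
      2F → solve 8 (identity 2F) refl a₀ a₁ a₂ a₃ v₀ v₁ v₂ v₃
      3F → solve 8 (identity 3F) refl a₀ a₁ a₂ a₃ v₀ v₁ v₂ v₃
    where
    a₀ a₁ a₂ a₃ v₀ v₁ v₂ v₃ : Carrier
    a₀ = a 0F; a₁ = a 1F; a₂ = a 2F; a₃ = a 3F
    v₀ = v 0F; v₁ = v 1F; v₂ = v 2F; v₃ = v 3F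
    identity : Fin 4 → Equation 8
    identity k a₀ a₁ a₂ a₃ v₀ v₁ v₂ v₃ =
      let A = ᴾ.vec a₀ a₁ a₂ a₃; V = ᴾ.vec v₀ v₁ v₂ v₃ in
      A ᴾ.· V := A k :* V k :+ A ᴾ.·⟨ complement k ⟩ V

  cramer : ∀ t x u v w {m} → m ∈ᵗ t →
           minor t u v w * x m ≈ minor t x v w * u m + minor t u x w * v m + minor t u v x * w m
  cramer (triple i j l) x u v w = λ where
      (inj₁ ≡.refl)        → solve 12 (identity 0F) refl u₀ u₁ u₂ v₀ v₁ v₂ w₀ w₁ w₂ x₀ x₁ x₂
      (inj₂ (inj₁ ≡.refl)) → solve 12 (identity 1F) refl u₀ u₁ u₂ v₀ v₁ v₂ w₀ w₁ w₂ x₀ x₁ x₂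
      (inj₂ (inj₂ ≡.refl)) → solve 12 (identity 2F) refl u₀ u₁ u₂ v₀ v₁ v₂ w₀ w₁ w₂ x₀ x₁ x₂
    where
    u₀ u₁ u₂ v₀ v₁ v₂ w₀ w₁ w₂ x₀ x₁ x₂ : Carrier
    u₀ = u i; u₁ = u j; u₂ = u l; v₀ = v i; v₁ = v j; v₂ = v l
    w₀ = w i; w₁ = w j; w₂ = w l; x₀ = x i; x₁ = x j; x₂ = x l
    identity : Fin 4 → Equation 12
    identity p u₀ u₁ u₂ v₀ v₁ v₂ w₀ w₁ w₂ x₀ x₁ x₂ =
      let o = con (+ 0); t = triple 0F 1F 2F
          U = ᴾ.vec u₀ u₁ u₂ o; V = ᴾ.vec v₀ v₁ v₂ o
          W = ᴾ.vec w₀ w₁ w₂ o; X = ᴾ.vec x₀ x₁ x₂ o in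
      ᴾ.minor t U V W :* X p
        := ᴾ.minor t X V W :* U p :+ ᴾ.minor t U X W :* V p :+ ᴾ.minor t U V X :* W p

  distribute-inverse : ∀ d⁻¹ α β γ x y z →
    d⁻¹ * (α * x + β * y + γ * z) ≈ α * d⁻¹ * x + β * d⁻¹ * y + γ * d⁻¹ * z
  distribute-inverse = solve 7 (λ d⁻¹ α β γ x y z →
    d⁻¹ :* (α :* x :+ β :* y :+ γ :* z) := α :* d⁻¹ :* x :+ β :* d⁻¹ :* y :+ γ :* d⁻¹ :* z) refl

  -- Cramer's rule in the three coordinates other than k recovers those
  -- coordinates of x; the plane equation, solved for x k, recovers the last one.
  spans-by-cramer : ∀ {a u v w} k → ¬ a k ≈ 0# → ¬ cross u v w k ≈ 0# →
                    OnPlane a u → OnPlane a v → OnPlane a w → SpansPlane a u v w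
  spans-by-cramer {a} {u} {v} {w} k ak≉0 D≉0 u∈a v∈a w∈a =
    u∈a , v∈a , w∈a , λ x x∈a → α x , β x , γ x , coordinates x x∈a
    where
    t : Triple
    t = complement k
    D D⁻¹ : Carrier
    D = cross u v w k
    D⁻¹ = proj₁ (inverse D D≉0)
    α β γ : Vec4 → Carrier
    α x = cross x v w k * D⁻¹
    β x = cross u x w k * D⁻¹
    γ x = cross u v x k * D⁻¹
    y : Vec4 → Vec4
    y x = lin3 (α x) u (β x) v (γ x) w
    off-k : ∀ x m → m ∈ᵗ t → x m ≈ y x m
    off-k x m m∈t = trans (move-inverse (proj₂ (inverse D D≉0)) (cramer t x u v w m∈t))
                          (distribute-inverse D⁻¹ _ _ _ (u m) (v m) (w m))
    y∈a : ∀ x → OnPlane a (y x)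
    y∈a x = begin
      a · y x                                        ≈⟨ ·-lin3 a (α x) u (β x) v (γ x) w ⟩
      α x * (a · u) + β x * (a · v) + γ x * (a · w)  ≈⟨ ideal-member≈0 (α x) (β x) (γ x) u∈a v∈a w∈a ⟩
      0#                                             ∎
    at-k : ∀ x → OnPlane a x → x k ≈ y x k
    at-k x x∈a = *-cancelˡ-≉0 ak≉0 (+-cancelʳ (a ·⟨ t ⟩ y x) _ _ (begin
      a k * x k + a ·⟨ t ⟩ y x    ≈⟨ +-congˡ (·⟨⟩-cong a t (off-k x)) ⟨
      a k * x k + a ·⟨ t ⟩ x      ≈⟨ ·-split a x k ⟨
      a · x                       ≈⟨ trans x∈a (sym (y∈a x)) ⟩
      a · y x                     ≈⟨ ·-split a (y x) k ⟩
      a k * y x k + a ·⟨ t ⟩ y x  ∎))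
    coordinates : ∀ x → OnPlane a x → x ≈v y x
    coordinates x x∈a m with complement-cover k m
    ... | inj₁ ≡.refl = at-k x x∈a
    ... | inj₂ m∈t    = off-k x m m∈t

  spans-if-cross≉0 : ∀ {a u v w} → NonZero a → (∀ k → ¬ a k ≈ 0# → ¬ cross u v w k ≈ 0#) →
                     OnPlane a u → OnPlane a v → OnPlane a w → SpansPlane a u v w
  spans-if-cross≉0 {a} a≉0 cross≉0 with nonzero-coordinate a≉0
  ... | k , ak≉0 = spans-by-cramer {a} k ak≉0 (cross≉0 k ak≉0)

  spans-if-cross≈ : ∀ {a u v w μ} → NonZero a → ¬ μ ≈ 0# → cross u v w ≈v (μ • a) →
                    OnPlane a u → OnPlane a v → OnPlane a w → SpansPlane a u v w
  spans-if-cross≈ {a} a≉0 μ≉0 cross≈μa =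
    spans-if-cross≉0 {a} a≉0 (λ k ak≉0 → *-≉0 μ≉0 ak≉0 ∘ trans (sym (cross≈μa k)))

  l₁-point-on-plane : ∀ a → OnPlane a (l₁-point a)
  l₁-point-on-plane a = solve 4 (λ a₀ a₁ a₂ a₃ → let A = ᴾ.vec a₀ a₁ a₂ a₃ in
    A ᴾ.· ᴾ.l₁-point A := con (+ 0)) refl (a 0F) (a 1F) (a 2F) (a 3F)

  l₂-point-on-plane : ∀ a → OnPlane a (l₂-point a)
  l₂-point-on-plane a = solve 4 (λ a₀ a₁ a₂ a₃ → let A = ᴾ.vec a₀ a₁ a₂ a₃ in
    A ᴾ.· ᴾ.l₂-point A := con (+ 0)) refl (a 0F) (a 1F) (a 2F) (a 3F)

  l₃-point-on-plane : ∀ a → OnPlane a (l₃-point a)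
  l₃-point-on-plane a = solve 4 (λ a₀ a₁ a₂ a₃ → let A = ᴾ.vec a₀ a₁ a₂ a₃ in
    A ᴾ.· ᴾ.l₃-point A := con (+ 0)) refl (a 0F) (a 1F) (a 2F) (a 3F)

  l₁-point≉0 : ∀ {a} → ¬ (a 1F ≈ 0# × a 3F ≈ 0#) → NonZero (l₁-point a)
  l₁-point≉0 ¬both l₁≈0 = ¬both (-x≈0⇒x≈0 (l₁≈0 3F) , l₁≈0 1F)

  l₂-point≉0 : ∀ {a} → ¬ (a 0F ≈ 0# × a 2F ≈ 0#) → NonZero (l₂-point a)
  l₂-point≉0 ¬both l₂≈0 = ¬both (-x≈0⇒x≈0 (l₂≈0 2F) , l₂≈0 0F)

  l₃-point≉0 : ∀ {a} → ¬ quad a ≈ 0# → NonZero (l₃-point a)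
  l₃-point≉0 {a} quad≉0 l₃≈0 = quad≉0 (begin
    quad a                                             ≈⟨ identity (a 0F) (a 1F) (a 2F) (a 3F) ⟩
    - a 3F * (a 1F + a 2F) + - a 1F * - (a 0F + a 3F)  ≈⟨ +-cong (*-congˡ (l₃≈0 0F)) (*-congˡ (l₃≈0 1F)) ⟩
    - a 3F * 0# + - a 1F * 0#                          ≈⟨ +-cong (zeroʳ _) (zeroʳ _) ⟩
    0# + 0#                                            ≈⟨ +-identityʳ 0# ⟩
    0#                                                 ∎)
    where
    identity : ∀ a₀ a₁ a₂ a₃ → a₀ * a₁ - a₂ * a₃ ≈ - a₃ * (a₁ + a₂) + - a₁ * - (a₀ + a₃)
    identity = solve 4 (λ a₀ a₁ a₂ a₃ →
      a₀ :* a₁ :- a₂ :* a₃ := :- a₃ :* (a₁ :+ a₂) :+ :- a₁ :* :- (a₀ :+ a₃)) refl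

  cross-l₁l₂l₃ : ∀ a → cross (l₁-point a) (l₂-point a) (l₃-point a) ≈v (quad a • a)
  cross-l₁l₂l₃ a = λ where
      0F → solve 4 (identity 0F) refl (a 0F) (a 1F) (a 2F) (a 3F)
      1F → solve 4 (identity 1F) refl (a 0F) (a 1F) (a 2F) (a 3F)
      2F → solve 4 (identity 2F) refl (a 0F) (a 1F) (a 2F) (a 3F)
      3F → solve 4 (identity 3F) refl (a 0F) (a 1F) (a 2F) (a 3F)
    where
    identity : Fin 4 → Equation 4
    identity k a₀ a₁ a₂ a₃ = let A = ᴾ.vec a₀ a₁ a₂ a₃ in
      ᴾ.cross (ᴾ.l₁-point A) (ᴾ.l₂-point A) (ᴾ.l₃-point A) k := ᴾ.quad A :* A k

  cross-l₁l₂ : ∀ a r → OnPlane a r →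
               cross (l₁-point a) (l₂-point a) r ≈v ((a 0F * r 0F + a 2F * r 2F) • a)
  cross-l₁l₂ a r r∈a = λ where
      0F → ≈-modulo (solve 8 (identity 0F) refl a₀ a₁ a₂ a₃ r₀ r₁ r₂ r₃) r∈a
      1F → ≈-modulo (solve 8 (identity 1F) refl a₀ a₁ a₂ a₃ r₀ r₁ r₂ r₃) r∈a
      2F → ≈-modulo (solve 8 (identity 2F) refl a₀ a₁ a₂ a₃ r₀ r₁ r₂ r₃) r∈a
      3F → ≈-modulo (solve 8 (identity 3F) refl a₀ a₁ a₂ a₃ r₀ r₁ r₂ r₃) r∈a
    where
    a₀ a₁ a₂ a₃ r₀ r₁ r₂ r₃ : Carrier
    a₀ = a 0F; a₁ = a 1F; a₂ = a 2F; a₃ = a 3F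
    r₀ = r 0F; r₁ = r 1F; r₂ = r 2F; r₃ = r 3F
    identity : Fin 4 → Equation 8
    identity k a₀ a₁ a₂ a₃ r₀ r₁ r₂ r₃ =
      let A = ᴾ.vec a₀ a₁ a₂ a₃; R = ᴾ.vec r₀ r₁ r₂ r₃; o = con (+ 0) in
      ᴾ.cross (ᴾ.l₁-point A) (ᴾ.l₂-point A) R k :+ (A ᴾ.· R) :* ᴾ.vec a₀ o a₂ o k
        := (a₀ :* r₀ :+ a₂ :* r₂) :* A k

  cross-e₁e₃l₂ : ∀ a → cross (e 1F) (e 3F) (l₂-point a) 0F ≈ a 0F ×
                       cross (e 1F) (e 3F) (l₂-point a) 2F ≈ a 2F
  cross-e₁e₃l₂ a = solve 4 (identity 0F) refl a₀ a₁ a₂ a₃ , solve 4 (identity 2F) refl a₀ a₁ a₂ a₃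
    where
    a₀ a₁ a₂ a₃ : Carrier
    a₀ = a 0F; a₁ = a 1F; a₂ = a 2F; a₃ = a 3F
    identity : Fin 4 → Equation 4
    identity k a₀ a₁ a₂ a₃ = let A = ᴾ.vec a₀ a₁ a₂ a₃ in
      ᴾ.cross (ᴾ.e 1F) (ᴾ.e 3F) (ᴾ.l₂-point A) k := A k

  cross-e₀e₂l₁ : ∀ a → cross (e 0F) (e 2F) (l₁-point a) 1F ≈ a 1F ×
                       cross (e 0F) (e 2F) (l₁-point a) 3F ≈ a 3F
  cross-e₀e₂l₁ a = solve 4 (identity 1F) refl a₀ a₁ a₂ a₃ , solve 4 (identity 3F) refl a₀ a₁ a₂ a₃
    where
    a₀ a₁ a₂ a₃ : Carrier
    a₀ = a 0F; a₁ = a 1F; a₂ = a 2F; a₃ = a 3F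
    identity : Fin 4 → Equation 4
    identity k a₀ a₁ a₂ a₃ = let A = ᴾ.vec a₀ a₁ a₂ a₃ in
      ᴾ.cross (ᴾ.e 0F) (ᴾ.e 2F) (ᴾ.l₁-point A) k := A k

  -- Each product a i * a j * quad r (i odd, j even) is a combination of the
  -- multiplier of cross-l₁l₂, a · r and quad a.
  tangent-plane-point-on-Q : ∀ {a r} → quad a ≈ 0# → OnPlane a r →
    a 0F * r 0F + a 2F * r 2F ≈ 0# →
    ¬ (a 1F ≈ 0# × a 3F ≈ 0#) → ¬ (a 0F ≈ 0# × a 2F ≈ 0#) → quad r ≈ 0#
  tangent-plane-point-on-Q {a} {r} quad≈0 r∈a τ≈0 ¬a₁₃≈0 ¬a₀₂≈0 =
    cases (≉0-pair ¬a₁₃≈0) (≉0-pair ¬a₀₂≈0)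
    where
    a₀ a₁ a₂ a₃ r₀ r₁ r₂ r₃ : Carrier
    a₀ = a 0F; a₁ = a 1F; a₂ = a 2F; a₃ = a 3F
    r₀ = r 0F; r₁ = r 1F; r₂ = r 2F; r₃ = r 3F
    ideal : (i j : Fin 4) (X Y Z : (Fin 4 → Polynomial 8) → (Fin 4 → Polynomial 8) → Polynomial 8) →
            Equation 8
    ideal i j X Y Z a₀ a₁ a₂ a₃ r₀ r₁ r₂ r₃ =
      let A = ᴾ.vec a₀ a₁ a₂ a₃; R = ᴾ.vec r₀ r₁ r₂ r₃ in
      A i :* A j :* ᴾ.quad R
        := X A R :* (a₀ :* r₀ :+ a₂ :* r₂) :+ Y A R :* (A ᴾ.· R) :+ Z A R :* ᴾ.quad A
    by : ∀ {i j X Y Z} → ¬ a i ≈ 0# → ¬ a j ≈ 0# →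
         a i * a j * quad r ≈ X * (a₀ * r₀ + a₂ * r₂) + Y * (a · r) + Z * quad a → quad r ≈ 0#
    by ai≉0 aj≉0 identity =
      x*y≈0⇒y≈0 (*-≉0 ai≉0 aj≉0) (trans identity (ideal-member≈0 _ _ _ τ≈0 r∈a quad≈0))
    cases : ¬ a 1F ≈ 0# ⊎ ¬ a 3F ≈ 0# → ¬ a 0F ≈ 0# ⊎ ¬ a 2F ≈ 0# → quad r ≈ 0#
    cases (inj₁ a₁≉0) (inj₁ a₀≉0) = by a₁≉0 a₀≉0 (solve 8 (ideal 1F 0F
          (λ A R → A 1F :* R 1F :+ A 2F :* R 2F) (λ A R → :- (A 2F :* R 2F)) (λ A R → :- (R 2F :* R 3F)))
          refl a₀ a₁ a₂ a₃ r₀ r₁ r₂ r₃)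
    cases (inj₁ a₁≉0) (inj₂ a₂≉0) = by a₁≉0 a₂≉0 (solve 8 (ideal 1F 2F
          (λ A R → :- (A 2F :* R 0F :+ A 1F :* R 3F)) (λ A R → A 2F :* R 0F) (λ A R → R 0F :* R 3F))
          refl a₀ a₁ a₂ a₃ r₀ r₁ r₂ r₃)
    cases (inj₂ a₃≉0) (inj₁ a₀≉0) = by a₃≉0 a₀≉0 (solve 8 (ideal 3F 0F
          (λ A R → A 3F :* R 1F :+ A 0F :* R 2F) (λ A R → :- (A 0F :* R 2F)) (λ A R → R 1F :* R 2F))
          refl a₀ a₁ a₂ a₃ r₀ r₁ r₂ r₃)
    cases (inj₂ a₃≉0) (inj₂ a₂≉0) = by a₃≉0 a₂≉0 (solve 8 (ideal 3F 2F
          (λ A R → A 1F :* R 1F :+ A 2F :* R 2F) (λ A R → :- (A 2F :* R 2F)) (λ A R → :- (R 0F :* R 1F)))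
          refl a₀ a₁ a₂ a₃ r₀ r₁ r₂ r₃)

  ·-e : ∀ a k → a · e k ≈ a k
  ·-e a = λ where
      0F → solve 4 (identity 0F) refl (a 0F) (a 1F) (a 2F) (a 3F)
      1F → solve 4 (identity 1F) refl (a 0F) (a 1F) (a 2F) (a 3F)
      2F → solve 4 (identity 2F) refl (a 0F) (a 1F) (a 2F) (a 3F)
      3F → solve 4 (identity 3F) refl (a 0F) (a 1F) (a 2F) (a 3F)
    where
    identity : Fin 4 → Equation 4
    identity k a₀ a₁ a₂ a₃ = let A = ᴾ.vec a₀ a₁ a₂ a₃ in A ᴾ.· ᴾ.e k := A k

  e≉0 : ∀ k → NonZero (e k)
  e≉0 0F e≈0 = 1≉0 (e≈0 0F)
  e≉0 1F e≈0 = 1≉0 (e≈0 1F)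
  e≉0 2F e≈0 = 1≉0 (e≈0 2F)
  e≉0 3F e≈0 = 1≉0 (e≈0 3F)

  plane⊇l₁ : ∀ {a} → NonZero a → a 1F ≈ 0# × a 3F ≈ 0# →
             SpansPlane a (e 1F) (e 3F) (l₂-point a)
  plane⊇l₁ {a} a≉0 (a₁≈0 , a₃≈0) = spans-if-cross≉0 {a} a≉0 cross≉0
    (trans (·-e a 1F) a₁≈0) (trans (·-e a 3F) a₃≈0) (l₂-point-on-plane a)
    where
    cross≉0 : ∀ k → ¬ a k ≈ 0# → ¬ cross (e 1F) (e 3F) (l₂-point a) k ≈ 0#
    cross≉0 0F a₀≉0 = a₀≉0 ∘ trans (sym (proj₁ (cross-e₁e₃l₂ a)))
    cross≉0 1F a₁≉0 = contradiction a₁≈0 a₁≉0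
    cross≉0 2F a₂≉0 = a₂≉0 ∘ trans (sym (proj₂ (cross-e₁e₃l₂ a)))
    cross≉0 3F a₃≉0 = contradiction a₃≈0 a₃≉0

  plane⊇l₂ : ∀ {a} → NonZero a → a 0F ≈ 0# × a 2F ≈ 0# →
             SpansPlane a (e 0F) (e 2F) (l₁-point a)
  plane⊇l₂ {a} a≉0 (a₀≈0 , a₂≈0) = spans-if-cross≉0 {a} a≉0 cross≉0
    (trans (·-e a 0F) a₀≈0) (trans (·-e a 2F) a₂≈0) (l₁-point-on-plane a)
    where
    cross≉0 : ∀ k → ¬ a k ≈ 0# → ¬ cross (e 0F) (e 2F) (l₁-point a) k ≈ 0#
    cross≉0 0F a₀≉0 = contradiction a₀≈0 a₀≉0
    cross≉0 1F a₁≉0 = a₁≉0 ∘ trans (sym (proj₁ (cross-e₀e₂l₁ a)))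
    cross≉0 2F a₂≉0 = contradiction a₂≈0 a₂≉0
    cross≉0 3F a₃≉0 = a₃≉0 ∘ trans (sym (proj₂ (cross-e₀e₂l₁ a)))

  plane-meets-line : ∀ {u w} → Indep2 u w → ∀ a →
                     ∃ λ r → NonZero r × OnLine u w r × OnPlane a r
  plane-meets-line {u} {w} ind a with (a · u) ≟ 0#
  ... | yes u∈a = u , u≉0 , (1# , 0# , λ i → sym (1*x+0*y≈x (u i) (w i))) , u∈a
    where
    u≉0 : NonZero u
    u≉0 u≈0 = 1≉0 (proj₁ (ind 1# 0# λ i → trans (1*x+0*y≈x (u i) (w i)) (u≈0 i)))
  ... | no  u∉a = lin2 (a · w) u (- (a · u)) w , r≉0 , (a · w , - (a · u) , λ _ → refl) , r∈a
    where
    r≉0 : NonZero (lin2 (a · w) u (- (a · u)) w)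
    r≉0 r≈0 = u∉a (-x≈0⇒x≈0 (proj₂ (ind _ _ r≈0)))
    r∈a : OnPlane a (lin2 (a · w) u (- (a · u)) w)
    r∈a = trans (·-lin2 a (a · w) u (- (a · u)) w)
                (solve 2 (λ x y → x :* y :+ :- y :* x := con (+ 0)) refl (a · w) (a · u))

  blocking : ∀ {u w} → Indep2 u w → DisjointFromQ u w → ThreeFoldStrongBlocking (InB u w)
  blocking {u} {w} ind dis a a≉0 with a 1F ≟ 0# ×-dec a 3F ≟ 0# | a 0F ≟ 0# ×-dec a 2F ≟ 0#
  ... | yes (a₁≈0 , a₃≈0) | yes (a₀≈0 , a₂≈0) =
    contradiction (λ { 0F → a₀≈0 ; 1F → a₁≈0 ; 2F → a₂≈0 ; 3F → a₃≈0 }) a≉0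
  ... | yes a₁₃≈0 | no ¬a₀₂≈0 =
    e 1F , e 3F , l₂-point a ,
    (e≉0 1F , inj₁ (refl , refl)) , (e≉0 3F , inj₁ (refl , refl)) ,
    (l₂-point≉0 {a} ¬a₀₂≈0 , inj₂ (inj₁ (refl , refl))) , plane⊇l₁ a≉0 a₁₃≈0
  ... | no ¬a₁₃≈0 | yes a₀₂≈0 =
    e 0F , e 2F , l₁-point a ,
    (e≉0 0F , inj₂ (inj₁ (refl , refl))) , (e≉0 2F , inj₂ (inj₁ (refl , refl))) ,
    (l₁-point≉0 {a} ¬a₁₃≈0 , inj₁ (refl , refl)) , plane⊇l₂ a≉0 a₀₂≈0
  ... | no ¬a₁₃≈0 | no ¬a₀₂≈0 with quad a ≟ 0#
  ...   | no quad≉0 =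
    l₁-point a , l₂-point a , l₃-point a ,
    (l₁-point≉0 {a} ¬a₁₃≈0 , inj₁ (refl , refl)) ,
    (l₂-point≉0 {a} ¬a₀₂≈0 , inj₂ (inj₁ (refl , refl))) ,
    (l₃-point≉0 {a} quad≉0 , inj₂ (inj₂ (inj₁ (refl , refl)))) ,
    spans-if-cross≈ {a} a≉0 quad≉0 (cross-l₁l₂l₃ a)
      (l₁-point-on-plane a) (l₂-point-on-plane a) (l₃-point-on-plane a)
  ...   | yes quad≈0 with plane-meets-line ind a
  ...     | r , r≉0 , r∈g , r∈a =
    l₁-point a , l₂-point a , r ,
    (l₁-point≉0 {a} ¬a₁₃≈0 , inj₁ (refl , refl)) ,
    (l₂-point≉0 {a} ¬a₀₂≈0 , inj₂ (inj₁ (refl , refl))) ,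
    (r≉0 , inj₂ (inj₂ (inj₂ r∈g))) ,
    spans-if-cross≈ {a} a≉0 τ≉0 (cross-l₁l₂ a r r∈a) (l₁-point-on-plane a) (l₂-point-on-plane a) r∈a
    where
    τ≉0 : ¬ a 0F * r 0F + a 2F * r 2F ≈ 0#
    τ≉0 τ≈0 = dis r r≉0 r∈g (x∙y⁻¹≈ε⇒x≈y _ _
      (tangent-plane-point-on-Q {a} {r} quad≈0 r∈a τ≈0 ¬a₁₃≈0 ¬a₀₂≈0))

  Points : (Vec4 → Set) → Vec4 → Set
  Points L v = NonZero v × L v

  ScalingClosed : (Vec4 → Set) → Set
  ScalingClosed L = ∀ {x y} → SamePoint x y → L y → L x

  Apart : (Vec4 → Set) → (Vec4 → Set) → Set
  Apart L L' = ∀ {x} → NonZero x → L x → L' x → ⊥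

  ∪-closed : ∀ {L L'} → ScalingClosed L → ScalingClosed L' → ScalingClosed (L ∪ L')
  ∪-closed closed closed' x~y = Sum.map (closed x~y) (closed' x~y)

  Apart-∪ : ∀ {L L' L''} → Apart L L' → Apart L L'' → Apart L (L' ∪ L'')
  Apart-∪ apart apart' x≉0 x∈L = Sum.[ apart x≉0 x∈L , apart' x≉0 x∈L ]

  HasSize-∪ : ∀ {L L' m n} → ScalingClosed L → ScalingClosed L' → Apart L L' →
              HasSize (Points L) m → HasSize (Points L') n → HasSize (Points (L ∪ L')) (m ℕ.+ n)
  HasSize-∪ {L} {L'} {m} {n} closed closed' apart (f , f∈ , f-inj , f-onto) (g , g∈ , g-inj , g-onto) =
    h ∘ splitAt m , h∈ ∘ splitAt m , inj , onto
    where
    h : Fin m ⊎ Fin n → Vec4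
    h = Sum.[ f , g ]
    h∈ : ∀ s → Points (L ∪ L') (h s)
    h∈ (inj₁ i) = proj₁ (f∈ i) , inj₁ (proj₂ (f∈ i))
    h∈ (inj₂ j) = proj₁ (g∈ j) , inj₂ (proj₂ (g∈ j))
    h-inj : ∀ s t → SamePoint (h s) (h t) → s ≡ t
    h-inj (inj₁ i) (inj₁ j) p = ≡.cong inj₁ (f-inj i j p)
    h-inj (inj₂ i) (inj₂ j) p = ≡.cong inj₂ (g-inj i j p)
    h-inj (inj₁ i) (inj₂ j) p =
      ⊥-elim (apart (proj₁ (f∈ i)) (proj₂ (f∈ i)) (closed' p (proj₂ (g∈ j))))
    h-inj (inj₂ i) (inj₁ j) p =
      ⊥-elim (apart (proj₁ (g∈ i)) (closed p (proj₂ (f∈ j))) (proj₂ (g∈ i)))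
    inj : ∀ i j → SamePoint (h (splitAt m i)) (h (splitAt m j)) → i ≡ j
    inj i j p = ≡.trans (≡.sym (join-splitAt m n i))
                (≡.trans (≡.cong (join m n) (h-inj (splitAt m i) (splitAt m j) p)) (join-splitAt m n j))
    at : ∀ {v} s → SamePoint v (h s) → ∃ λ i → SamePoint v (h (splitAt m i))
    at {v} s p = join m n s , ≡.subst (SamePoint v ∘ h) (≡.sym (splitAt-join m n s)) p
    onto : ∀ v → Points (L ∪ L') v → ∃ λ i → SamePoint v (h (splitAt m i))
    onto v (v≉0 , inj₁ v∈L)  = let i , p = f-onto v (v≉0 , v∈L)  in at (inj₁ i) p
    onto v (v≉0 , inj₂ v∈L') = let j , p = g-onto v (v≉0 , v∈L') in at (inj₂ j) p

  scale-lin2 : ∀ c α u β w → (c • lin2 α u β w) ≈v lin2 (c * α) u (c * β) w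
  scale-lin2 c α u β w i = solve 5 (λ c α x β y → c :* (α :* x :+ β :* y) := c :* α :* x :+ c :* β :* y)
    refl c α (u i) β (w i)

  lin2-cong : ∀ {α α' β β'} u w → α ≈ α' → β ≈ β' → lin2 α u β w ≈v lin2 α' u β' w
  lin2-cong u w α≈α' β≈β' i = +-cong (*-congʳ α≈α') (*-congʳ β≈β')

  lin2-injective : ∀ {u w α α' β β'} → Indep2 u w →
                   lin2 α u β w ≈v lin2 α' u β' w → α ≈ α' × β ≈ β'
  lin2-injective {u} {w} {α} {α'} {β} {β'} ind p =
    let α-α'≈0 , β-β'≈0 = ind (α - α') (β - β') λ i →
          trans (identity α α' (u i) β β' (w i)) (x≈y⇒x∙y⁻¹≈ε (p i))
    in x∙y⁻¹≈ε⇒x≈y α α' α-α'≈0 , x∙y⁻¹≈ε⇒x≈y β β' β-β'≈0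
    where
    identity : ∀ α α' x β β' y → (α - α') * x + (β - β') * y ≈ (α * x + β * y) - (α' * x + β' * y)
    identity = solve 6 (λ α α' x β β' y →
      (α :- α') :* x :+ (β :- β') :* y := (α :* x :+ β :* y) :- (α' :* x :+ β' :* y)) refl

  span-closed : ∀ {u w} → ScalingClosed (OnLine u w)
  span-closed {u} {w} (c , x≈cy) (α , β , y≈) =
    c * α , c * β , λ i → trans (x≈cy i) (trans (*-congˡ (y≈ i)) (scale-lin2 c α u β w i))

  -- The q + 1 points of the line are w and u + t w (t ∈ F), i.e. the points
  -- with coordinates (0 : 1) and (1 : t) with respect to u, w.
  HasSize-span : ∀ {u w} → Indep2 u w → HasSize (Points (OnLine u w)) (suc q)
  HasSize-span {u} {w} ind = point , point∈ , point-inj , point-onto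
    where
    α β : Fin (suc q) → Carrier
    α 0F      = 0#
    α (Fin.suc _) = 1#
    β 0F      = 1#
    β (Fin.suc i) = enum i
    point : Fin (suc q) → Vec4
    point i = lin2 (α i) u (β i) w
    point∈ : ∀ i → Points (OnLine u w) (point i)
    point∈ 0F      = (λ p → 1≉0 (proj₂ (ind _ _ p))) , _ , _ , λ _ → refl
    point∈ (Fin.suc i) = (λ p → 1≉0 (proj₁ (ind _ _ p))) , _ , _ , λ _ → refl
    same : ∀ {i j c} → (point i ≈v (c • point j)) → α i ≈ c * α j × β i ≈ c * β j
    same {i} {j} {c} p = lin2-injective ind λ k → trans (p k) (scale-lin2 c (α j) u (β j) w k)
    point-inj : ∀ i j → SamePoint (point i) (point j) → i ≡ j
    point-inj 0F 0F _ = ≡.refl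
    point-inj 0F (Fin.suc j) (c , p) = let 0≈c , 1≈ct = same {0F} {Fin.suc j} p in
      contradiction (trans 1≈ct (trans (*-congʳ (sym (trans 0≈c (*-identityʳ c)))) (zeroˡ _))) 1≉0
    point-inj (Fin.suc i) 0F (c , p) = contradiction (trans (proj₁ (same {Fin.suc i} {0F} p)) (zeroʳ c)) 1≉0
    point-inj (Fin.suc i) (Fin.suc j) (c , p) = let 1≈c , tᵢ≈ctⱼ = same {Fin.suc i} {Fin.suc j} p in
      ≡.cong Fin.suc (enum-inj i j (trans tᵢ≈ctⱼ
        (trans (*-congʳ (sym (trans 1≈c (*-identityʳ c)))) (*-identityˡ _))))
    point-onto : ∀ v → Points (OnLine u w) v → ∃ λ i → SamePoint v (point i)
    point-onto v (_ , s , t , v≈) with s ≟ 0#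
    ... | yes s≈0 = 0F , t , λ k → trans (v≈ k) (trans
          (lin2-cong u w (trans s≈0 (sym (zeroʳ t))) (sym (*-identityʳ t)) k) (sym (scale-lin2 t 0# u 1# w k)))
    ... | no s≉0 with inverse s s≉0
    ... | s⁻¹ , ss⁻¹≈1 with enum-surj (t * s⁻¹)
    ... | j , tⱼ≈ts⁻¹ = Fin.suc j , s , λ k → trans (v≈ k) (trans
          (lin2-cong u w (sym (*-identityʳ s)) (sym s·tⱼ≈t) k) (sym (scale-lin2 s 1# u (enum j) w k)))
      where
      s·tⱼ≈t : s * enum j ≈ t
      s·tⱼ≈t = begin
        s * enum j      ≈⟨ *-congˡ tⱼ≈ts⁻¹ ⟩
        s * (t * s⁻¹)   ≈⟨ *-congˡ (*-comm t s⁻¹) ⟩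
        s * (s⁻¹ * t)   ≈⟨ *-assoc s s⁻¹ t ⟨
        s * s⁻¹ * t     ≈⟨ *-congʳ ss⁻¹≈1 ⟩
        1# * t          ≈⟨ *-identityˡ t ⟩
        t               ∎

  ≐-closed : ∀ {L L'} → L ≐ L' → ScalingClosed L' → ScalingClosed L
  ≐-closed (L⊆L' , L'⊆L) closed x~y y∈L = L'⊆L (closed x~y (L⊆L' y∈L))

  HasSize-≐ : ∀ {L L' n} → L ≐ L' → HasSize (Points L') n → HasSize (Points L) n
  HasSize-≐ (L⊆L' , L'⊆L) (f , f∈ , f-inj , f-onto) =
    f , (λ i → proj₁ (f∈ i) , L'⊆L (proj₂ (f∈ i))) , f-inj ,
    λ v (v≉0 , v∈L) → f-onto v (v≉0 , L⊆L' v∈L)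

  indep-by-pivots : ∀ {u w} i j → u i ≈ 1# → w i ≈ 0# → u j ≈ 0# → w j ≈ 1# → Indep2 u w
  indep-by-pivots i j uᵢ≈1 wᵢ≈0 uⱼ≈0 wⱼ≈1 α β p =
    trans (sym (trans (+-cong (*-congˡ uᵢ≈1) (*-congˡ wᵢ≈0)) (x*1+y*0≈x α β))) (p i) ,
    trans (sym (trans (+-cong (*-congˡ uⱼ≈0) (*-congˡ wⱼ≈1)) (x*0+y*1≈y α β))) (p j)

  l₁-span : OnL1 ≐ OnLine (e 1F) (e 3F)
  l₁-span = (λ {v} (x₀≈0 , x₂≈0) → v 1F , v 3F , λ where
               0F → trans x₀≈0 (sym (x*0+y*0≈0 _ _))
               1F → sym (x*1+y*0≈x _ _)
               2F → trans x₂≈0 (sym (x*0+y*0≈0 _ _))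
               3F → sym (x*0+y*1≈y _ _))
          , λ (s , t , v≈) → trans (v≈ 0F) (x*0+y*0≈0 s t) , trans (v≈ 2F) (x*0+y*0≈0 s t)

  l₂-span : OnL2 ≐ OnLine (e 0F) (e 2F)
  l₂-span = (λ {v} (x₁≈0 , x₃≈0) → v 0F , v 2F , λ where
               0F → sym (x*1+y*0≈x _ _)
               1F → trans x₁≈0 (sym (x*0+y*0≈0 _ _))
               2F → sym (x*0+y*1≈y _ _)
               3F → trans x₃≈0 (sym (x*0+y*0≈0 _ _)))
          , λ (s , t , v≈) → trans (v≈ 1F) (x*0+y*0≈0 s t) , trans (v≈ 3F) (x*0+y*0≈0 s t)

  l₃-span : OnL3 ≐ OnLine (vec 1# 0# 0# 1#) (vec 0# 1# 1# 0#)
  l₃-span = (λ {v} (x₀≈x₃ , x₁≈x₂) → v 0F , v 1F , λ where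
               0F → sym (x*1+y*0≈x _ _)
               1F → sym (x*0+y*1≈y _ _)
               2F → trans (sym x₁≈x₂) (sym (x*0+y*1≈y _ _))
               3F → trans (sym x₀≈x₃) (sym (x*1+y*0≈x _ _)))
          , λ (_ , _ , v≈) → trans (v≈ 0F) (sym (v≈ 3F)) , trans (v≈ 1F) (sym (v≈ 2F))

  l₁-l₂-apart : Apart OnL1 OnL2
  l₁-l₂-apart x≉0 (x₀≈0 , x₂≈0) (x₁≈0 , x₃≈0) =
    x≉0 λ { 0F → x₀≈0 ; 1F → x₁≈0 ; 2F → x₂≈0 ; 3F → x₃≈0 }

  l₁-l₃-apart : Apart OnL1 OnL3
  l₁-l₃-apart x≉0 (x₀≈0 , x₂≈0) (x₀≈x₃ , x₁≈x₂) =
    x≉0 λ { 0F → x₀≈0 ; 1F → trans x₁≈x₂ x₂≈0 ; 2F → x₂≈0 ; 3F → trans (sym x₀≈x₃) x₀≈0 }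

  l₂-l₃-apart : Apart OnL2 OnL3
  l₂-l₃-apart x≉0 (x₁≈0 , x₃≈0) (x₀≈x₃ , x₁≈x₂) =
    x≉0 λ { 0F → trans x₀≈x₃ x₃≈0 ; 1F → x₁≈0 ; 2F → trans (sym x₁≈x₂) x₁≈0 ; 3F → x₃≈0 }

  l₁⊆Q : ∀ x → OnL1 x → OnQ x
  l₁⊆Q _ (x₀≈0 , x₂≈0) =
    trans (*-congʳ x₀≈0) (trans (zeroˡ _) (sym (trans (*-congʳ x₂≈0) (zeroˡ _))))

  l₂⊆Q : ∀ x → OnL2 x → OnQ x
  l₂⊆Q _ (x₁≈0 , x₃≈0) =
    trans (*-congˡ x₁≈0) (trans (zeroʳ _) (sym (trans (*-congˡ x₃≈0) (zeroʳ _))))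

  l₃⊆Q : ∀ x → OnL3 x → OnQ x
  l₃⊆Q _ (x₀≈x₃ , x₁≈x₂) = trans (*-cong x₀≈x₃ x₁≈x₂) (*-comm _ _)

  size : ∀ {u w} → Indep2 u w → DisjointFromQ u w → HasSize (InB u w) (4 ℕ.* q ℕ.+ 4)
  size {u} {w} ind dis = ≡.subst (HasSize (InB u w)) (four-lines q)
    (HasSize-∪ l₁-closed (∪-closed l₂-closed (∪-closed l₃-closed span-closed))
       (Apart-∪ l₁-l₂-apart (Apart-∪ l₁-l₃-apart (off-Q l₁⊆Q))) l₁-size
       (HasSize-∪ l₂-closed (∪-closed l₃-closed span-closed)
          (Apart-∪ l₂-l₃-apart (off-Q l₂⊆Q)) l₂-size
          (HasSize-∪ l₃-closed span-closed (off-Q l₃⊆Q) l₃-size (HasSize-span ind))))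
    where
    four-lines : ∀ n → suc n ℕ.+ (suc n ℕ.+ (suc n ℕ.+ suc n)) ≡ 4 ℕ.* n ℕ.+ 4
    four-lines = solve-∀
    off-Q : ∀ {L} → (∀ x → L x → OnQ x) → Apart L (OnLine u w)
    off-Q L⊆Q {x} x≉0 x∈L x∈g = dis x x≉0 x∈g (L⊆Q x x∈L)
    l₁-closed : ScalingClosed OnL1
    l₂-closed : ScalingClosed OnL2
    l₃-closed : ScalingClosed OnL3
    l₁-closed = ≐-closed l₁-span span-closed
    l₂-closed = ≐-closed l₂-span span-closed
    l₃-closed = ≐-closed l₃-span span-closed
    l₁-size : HasSize (Points OnL1) (suc q)
    l₂-size : HasSize (Points OnL2) (suc q)
    l₃-size : HasSize (Points OnL3) (suc q)
    l₁-size = HasSize-≐ l₁-span (HasSize-span (indep-by-pivots 1F 3F refl refl refl refl))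
    l₂-size = HasSize-≐ l₂-span (HasSize-span (indep-by-pivots 0F 2F refl refl refl refl))
    l₃-size = HasSize-≐ l₃-span (HasSize-span (indep-by-pivots 0F 1F refl refl refl refl))

open import Data.Nat using (_+_; _*_)

theorem5 : (q : ℕ) (F : FiniteField q) (u w : PG.Vec4 F) →
    PG.Indep2 F u w → PG.DisjointFromQ F u w →
    PG.HasSize F (PG.InB F u w) (4 * q + 4) × PG.ThreeFoldStrongBlocking F (PG.InB F u w)
theorem5 q F u w ind dis = size F ind dis , blocking F ind dis
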